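{- Let $G=(V,E)$ be a nonempty simple graph with no isolated vertices such that $\Delta(G)\ge 2\,\mathrm{ad}(G)$. Then the number of $\Delta(G)$-weak edges in $G$ is at least $\frac{|E|}{2\,\mathrm{ad}(G)^2}$.
   Context: $\Delta(G)$ is the maximum degree and $\mathrm{ad}(G)=\frac{1}{|V|}\sum_{v\in V}d(v)$ the average degree of $G$. For an integer $D$ and a vertex $u$, $d^D(u)$ denotes the number of neighbors of $u$ of degree exactly $D$. For a statement $P$, $[P]$ is $1$ if $P$ holds and $0$ otherwise. An edge $uv$ is $(D,u)$-weak if $d^D(u)\le D-d(v)+[d(v)=D]$, and $uv$ is $D$-weak if it is $(D,u)$-weak or $(D,v)$-weak. -}

module Defs where

open import Data.Nat using (ℕ; zero; suc; _+_; _*_; _⊔_; _≤ᵇ_; _≡ᵇ_; _<ᵇ_)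
open import Data.Bool using (Bool; true; false; if_then_else_; _∧_; _∨_)
open import Data.Fin using (Fin; zero; suc; toℕ)
open import Relation.Binary.PropositionalEquality using (_≡_)

record Graph (n : ℕ) : Set where
  field
    adj   : Fin n → Fin n → Bool
    sym   : ∀ u v → adj u v ≡ adj v u
    irrefl : ∀ v → adj v v ≡ false
open Graph public

count : (n : ℕ) → (Fin n → Bool) → ℕ
count zero    p = 0
count (suc n) p = (if p zero then 1 else 0) + count n (λ i → p (suc i))

sumF : (n : ℕ) → (Fin n → ℕ) → ℕ
sumF zero    f = 0
sumF (suc n) f = f zero + sumF n (λ i → f (suc i))

maxF : (n : ℕ) → (Fin n → ℕ) → ℕ
maxF zero    f = 0
maxF (suc n) f = f zero ⊔ maxF n (λ i → f (suc i))

module _ {n : ℕ} (G : Graph n) where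

  deg : Fin n → ℕ
  deg v = count n (adj G v)

  maxDeg : ℕ
  maxDeg = maxF n deg

  numEdges : ℕ
  numEdges = sumF n (λ u → count n (λ v → (toℕ u <ᵇ toℕ v) ∧ adj G u v))

  degD : ℕ → Fin n → ℕ
  degD D u = count n (λ w → adj G u w ∧ (deg w ≡ᵇ D))

  iverson : Bool → ℕ
  iverson true  = 1
  iverson false = 0

  -- uv is (D,u)-weak:  d^D(u) ≤ D - d(v) + [d(v)=D]
  -- (stated as d^D(u) + d(v) ≤ D + [d(v)=D], the same inequality over ℤ)
  weakAt : ℕ → Fin n → Fin n → Bool
  weakAt D u v = (degD D u + deg v) ≤ᵇ (D + iverson (deg v ≡ᵇ D))

  weak : ℕ → Fin n → Fin n → Bool
  weak D u v = weakAt D u v ∨ weakAt D v u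

  numWeakEdges : ℕ → ℕ
  numWeakEdges D =
    sumF n (λ u → count n (λ v → (toℕ u <ᵇ toℕ v) ∧ adj G u v ∧ weak D u v))

{-# OPTIONS --safe #-}
module Submission where

-- Discharging.  Give each vertex v the charge 2·d(v) + Δ·w(v), where w(v) counts the Δ-weak
-- edges at v; by the handshake lemma the total is 4|E| + 2Δ·#weak.  Call x poor if w(x) = 0
-- and 2·d(x) ≤ Δ, and let every poor x receive ⌊Δ/d(x)⌋ − 1 from each neighbour.  Afterwards
-- every vertex holds more than Δ: a poor x because d(x)·⌊Δ/d(x)⌋ > Δ − d(x); a vertex that is
-- not poor and has no poor neighbour already did; and a vertex v with a poor neighbour has no
-- weak edge to any poor neighbour y, which forces d(y) ≥ Δ + 1 − d^Δ(v), so what v sends is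
-- covered by 2·d(v) − Δ − 1.  Hence n(Δ + 1) ≤ 4|E| + 2Δ·#weak, and together with n ≤ 2|E|
-- and 4|E| ≤ Δn, i.e. (Δn − 4|E|)(4|E| − n) ≥ 0, this yields n² ≤ 8|E|·#weak.

open import Data.Bool using (Bool; true; false; if_then_else_; _∧_; not; T)
open import Data.Bool.Properties using (∧-conicalˡ; ∧-conicalʳ; ∧-identityʳ; ∨-conicalʳ; ∨-comm; T-≡)
open import Data.Empty using (⊥-elim)
open import Data.Fin using (Fin; zero; suc; toℕ)
open import Data.Fin.Properties using (toℕ-injective)
open import Data.List using (_∷_; [])
open import Data.Nat
open import Data.Nat.DivMod using (_/_; _%_; m/n*n≤m; /-monoʳ-≤; m≡m%n+[m/n]*n; m%n<n)
open import Data.Nat.Properties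
open import Data.Nat.Tactic.RingSolver using (solve; solve-∀)
open import Data.Product using (∃; _,_)
open import Function using (_∘_)
open import Function.Bundles using (Equivalence)
open import Relation.Binary.PropositionalEquality
open import Relation.Nullary using (yes; no)
open import Relation.Nullary.Decidable using (dec-false)
open import Relation.Nullary.Reflects using (ofʸ; ofⁿ)
open import Algebra.Properties.CommutativeSemigroup +-commutativeSemigroup using (interchange)
open import Defs hiding (sym)

𝟙 : Bool → ℕ
𝟙 b = if b then 1 else 0

𝟙*≢0⇒true : ∀ {b c} → 𝟙 b * c ≢ 0 → b ≡ true
𝟙*≢0⇒true {true}  _   = refl
𝟙*≢0⇒true {false} 0≢0 = ⊥-elim (0≢0 refl)

count≡sumF𝟙 : ∀ n (p : Fin n → Bool) → count n p ≡ sumF n (λ i → 𝟙 (p i))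
count≡sumF𝟙 zero    p = refl
count≡sumF𝟙 (suc n) p = cong (𝟙 (p zero) +_) (count≡sumF𝟙 n (λ i → p (suc i)))

count≡0⇒false : ∀ n (p : Fin n → Bool) → count n p ≡ 0 → ∀ i → p i ≡ false
count≡0⇒false (suc n) p count≡0 i with p zero in p₀ | i
... | false | zero  = p₀
... | false | suc j = count≡0⇒false n (λ j → p (suc j)) count≡0 j

count-∧-split : ∀ n (p q : Fin n → Bool) →
                count n (λ i → p i ∧ q i) + count n (λ i → p i ∧ not (q i)) ≡ count n p
count-∧-split zero    p q = refl
count-∧-split (suc n) p q =
  trans (interchange (𝟙 (p zero ∧ q zero)) _ _ _)
        (cong₂ _+_ (𝟙-split (p zero) (q zero)) (count-∧-split n (p ∘ suc) (q ∘ suc)))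
  where
  𝟙-split : ∀ a b → 𝟙 (a ∧ b) + 𝟙 (a ∧ not b) ≡ 𝟙 a
  𝟙-split false _     = refl
  𝟙-split true  false = refl
  𝟙-split true  true  = refl

sumF-cong : ∀ n {f g : Fin n → ℕ} → (∀ i → f i ≡ g i) → sumF n f ≡ sumF n g
sumF-cong zero    f≗g = refl
sumF-cong (suc n) f≗g = cong₂ _+_ (f≗g zero) (sumF-cong n (f≗g ∘ suc))

sumF-mono-≤ : ∀ n {f g : Fin n → ℕ} → (∀ i → f i ≤ g i) → sumF n f ≤ sumF n g
sumF-mono-≤ zero    f≤g = z≤n
sumF-mono-≤ (suc n) f≤g = +-mono-≤ (f≤g zero) (sumF-mono-≤ n (f≤g ∘ suc))

sumF-distrib-+ : ∀ n (f g : Fin n → ℕ) → sumF n (λ i → f i + g i) ≡ sumF n f + sumF n g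
sumF-distrib-+ zero    f g = refl
sumF-distrib-+ (suc n) f g =
  trans (cong (f zero + g zero +_) (sumF-distrib-+ n (f ∘ suc) (g ∘ suc)))
        (interchange (f zero) (g zero) _ _)

sumF-*ˡ : ∀ n c (f : Fin n → ℕ) → sumF n (λ i → c * f i) ≡ c * sumF n f
sumF-*ˡ zero    c f = sym (*-zeroʳ c)
sumF-*ˡ (suc n) c f =
  trans (cong (c * f zero +_) (sumF-*ˡ n c (f ∘ suc))) (sym (*-distribˡ-+ c (f zero) _))

sumF-*ʳ : ∀ n c (f : Fin n → ℕ) → sumF n (λ i → f i * c) ≡ sumF n f * c
sumF-*ʳ zero    c f = refl
sumF-*ʳ (suc n) c f =
  trans (cong (f zero * c +_) (sumF-*ʳ n c (f ∘ suc))) (sym (*-distribʳ-+ c (f zero) _))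

sumF-const : ∀ n c → sumF n (λ _ → c) ≡ n * c
sumF-const zero    c = refl
sumF-const (suc n) c = cong (c +_) (sumF-const n c)

sumF-comm : ∀ m n (f : Fin m → Fin n → ℕ) →
            sumF m (λ i → sumF n (f i)) ≡ sumF n (λ j → sumF m (λ i → f i j))
sumF-comm zero    n f = sym (trans (sumF-const n 0) (*-zeroʳ n))
sumF-comm (suc m) n f =
  trans (cong (sumF n (f zero) +_) (sumF-comm m n (f ∘ suc))) (sym (sumF-distrib-+ n (f zero) _))

sumF≢0⇒∃≢0 : ∀ n (f : Fin n → ℕ) → sumF n f ≢ 0 → ∃ λ i → f i ≢ 0
sumF≢0⇒∃≢0 zero    f sum≢0 = ⊥-elim (sum≢0 refl)
sumF≢0⇒∃≢0 (suc n) f sum≢0 with f zero ≟ 0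
... | no  f₀≢0 = zero , f₀≢0
... | yes f₀≡0 with sumF≢0⇒∃≢0 n (f ∘ suc) (sum≢0 ∘ cong₂ _+_ f₀≡0)
...   | i , fᵢ≢0 = suc i , fᵢ≢0

f≤maxF : ∀ n (f : Fin n → ℕ) i → f i ≤ maxF n f
f≤maxF (suc n) f zero    = m≤m⊔n (f zero) _
f≤maxF (suc n) f (suc i) = ≤-trans (f≤maxF n (f ∘ suc) i) (m≤n⊔m (f zero) _)

handshake : ∀ n (R : Fin n → Fin n → Bool) →
            (∀ u v → R u v ≡ R v u) → (∀ v → R v v ≡ false) →
            sumF n (λ u → count n (R u)) ≡
            2 * sumF n (λ u → count n (λ v → (toℕ u <ᵇ toℕ v) ∧ R u v))
handshake n R R-sym R-irrefl = begin
    sumF n (λ u → count n (R u))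
  ≡⟨ sumF-cong n (λ u → trans (count≡sumF𝟙 n (R u)) (sumF-cong n (𝟙R-split u))) ⟩
    sumF n (λ u → sumF n (λ v → 𝟙 (R< u v) + 𝟙 (R< v u)))
  ≡⟨ sumF-cong n (λ u → sumF-distrib-+ n (𝟙 ∘ R< u) (λ v → 𝟙 (R< v u))) ⟩
    sumF n (λ u → sumF n (𝟙 ∘ R< u) + sumF n (λ v → 𝟙 (R< v u)))
  ≡⟨ sumF-distrib-+ n _ _ ⟩
    E + sumF n (λ u → sumF n (λ v → 𝟙 (R< v u)))
  ≡⟨ cong (E +_) (sumF-comm n n (λ u v → 𝟙 (R< v u))) ⟩
    E + E
  ≡⟨ cong (E +_) (sym (+-identityʳ E)) ⟩
    2 * E
  ≡⟨ cong (2 *_) (sumF-cong n (λ u → sym (count≡sumF𝟙 n (R< u)))) ⟩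
    2 * sumF n (λ u → count n (R< u))
  ∎
  where
  open ≡-Reasoning
  R< : Fin n → Fin n → Bool
  R< u v = (toℕ u <ᵇ toℕ v) ∧ R u v
  E : ℕ
  E = sumF n (λ u → sumF n (𝟙 ∘ R< u))
  𝟙R-split : ∀ u v → 𝟙 (R u v) ≡ 𝟙 (R< u v) + 𝟙 (R< v u)
  𝟙R-split u v with toℕ u <ᵇ toℕ v | <ᵇ-reflects-< (toℕ u) (toℕ v)
                  | toℕ v <ᵇ toℕ u | <ᵇ-reflects-< (toℕ v) (toℕ u)
  ... | true  | ofʸ u<v | true  | ofʸ v<u = ⊥-elim (<-asym u<v v<u)
  ... | true  | _       | false | _       = sym (+-identityʳ _)
  ... | false | _       | true  | _       = cong 𝟙 (R-sym u v)
  ... | false | ofⁿ u≮v | false | ofⁿ v≮u = cong 𝟙 (trans (cong (λ w → R w v) u≡v) (R-irrefl v))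
    where u≡v = toℕ-injective (≤-antisym (≮⇒≥ v≮u) (≮⇒≥ u≮v))

-- Turns a linear inequality into a ring identity, which the solver can check.
≤-by-slack : ∀ {x y a b} c → a ≤ b → y + a ≡ x + b + c → x ≤ y
≤-by-slack {x} {y} {a} {b} c a≤b eq = +-cancelʳ-≤ b x y (begin
  x + b      ≤⟨ m≤m+n (x + b) c ⟩
  x + b + c  ≡⟨ sym eq ⟩
  y + a      ≤⟨ +-monoʳ-≤ y a≤b ⟩
  y + b      ∎)
  where open ≤-Reasoning

D<2k+k*[D/k∸1] : ∀ D k .{{_ : NonZero k}} → D < 2 * k + k * (D / k ∸ 1)
D<2k+k*[D/k∸1] D k = subst (_< 2 * k + k * (D / k ∸ 1)) (sym (m≡m%n+[m/n]*n D k))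
                            (bound (D % k) (D / k) (m%n<n D k))
  where
  bound : ∀ r q → r < k → r + q * k < 2 * k + k * (q ∸ 1)
  bound r zero    r<k = ≤-by-slack k r<k (solve (k ∷ r ∷ []))
  bound r (suc q) r<k = ≤-by-slack 0 r<k eq
    where eq : 2 * k + k * q + suc r ≡ suc (r + suc q * k) + k + 0
          eq = solve (k ∷ r ∷ q ∷ [])

t*[q∸1]+h+t+s<2*[h+t] : ∀ h t s q → q * suc (t + s) ≤ h + t + s → 2 * suc (t + s) ≤ h + t + s →
                        t * (q ∸ 1) + suc (h + t + s) ≤ 2 * (h + t)
t*[q∸1]+h+t+s<2*[h+t] h t s zero          _    2K≤D = ≤-by-slack (2 * t + 1) 2K≤D (solve (h ∷ t ∷ s ∷ []))
t*[q∸1]+h+t+s<2*[h+t] h t s (suc zero)    _    2K≤D = ≤-by-slack (2 * t + 1) 2K≤D (solve (h ∷ t ∷ s ∷ []))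
t*[q∸1]+h+t+s<2*[h+t] h t s (suc (suc c)) qK≤D _    = ≤-by-slack (1 + t + c + c * s) qK≤D eq
  where eq : 2 * (h + t) + suc (suc c) * suc (t + s) ≡
             t * suc c + suc (h + t + s) + (h + t + s) + (1 + t + c + c * s)
        eq = solve (h ∷ t ∷ s ∷ c ∷ [])

-- (Dn − p)(p − n) ≥ 0, multiplied out.
p*p+n*n*D≤p*[n*1+D] : ∀ {n p D} → n ≤ p → p ≤ D * n → p * p + n * n * D ≤ p * (n * suc D)
p*p+n*n*D≤p*[n*1+D] {n} {p} {D} n≤p p≤Dn with m≤n⇒∃[o]m+o≡n n≤p
... | e , refl = begin
  (n + e) * (n + e) + n * n * D            ≡⟨ solve (n ∷ e ∷ D ∷ []) ⟩
  (n + e) * n + n * (D * n) + e * (n + e)  ≤⟨ +-monoʳ-≤ (_ + n * (D * n)) (*-monoʳ-≤ e p≤Dn) ⟩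
  (n + e) * n + n * (D * n) + e * (D * n)  ≡⟨ solve (n ∷ e ∷ D ∷ []) ⟩
  (n + e) * (n * suc D)                    ∎
  where open ≤-Reasoning

n*n≤p*W : ∀ {n p D W} .{{_ : NonZero D}} →
          n ≤ p → p ≤ D * n → n * suc D ≤ p + D * W → n * n ≤ p * W
n*n≤p*W {n} {p} {D} {W} n≤p p≤Dn n[1+D]≤p+DW =
  *-cancelʳ-≤ (n * n) (p * W) D (+-cancelˡ-≤ (p * p) (n * n * D) (p * W * D) (begin
    p * p + n * n * D  ≤⟨ p*p+n*n*D≤p*[n*1+D] n≤p p≤Dn ⟩
    p * (n * suc D)    ≤⟨ *-monoʳ-≤ p n[1+D]≤p+DW ⟩
    p * (p + D * W)    ≡⟨ solve (p ∷ D ∷ W ∷ []) ⟩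
    p * p + p * W * D  ∎))
  where open ≤-Reasoning

module Discharging {n} (G : Graph n) (deg≥1 : ∀ v → 1 ≤ deg G v) where

  Δ : ℕ
  Δ = maxDeg G

  d : Fin n → ℕ
  d = deg G

  weakDeg : Fin n → ℕ
  weakDeg v = count n (λ u → adj G v u ∧ weak G Δ v u)

  nonmaxDeg : Fin n → ℕ
  nonmaxDeg v = count n (λ u → adj G v u ∧ not (d u ≡ᵇ Δ))

  poor : Fin n → Bool
  poor x = (weakDeg x ≡ᵇ 0) ∧ (2 * d x ≤ᵇ Δ)

  share : ℕ → ℕ
  share zero    = 0
  share (suc k) = Δ / suc k ∸ 1

  transfer : Fin n → Fin n → ℕ
  transfer v x = 𝟙 (adj G v x ∧ poor x) * share (d x)

  sent received : Fin n → ℕ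
  sent v     = sumF n (transfer v)
  received x = sumF n (λ v → transfer v x)

  charge : Fin n → ℕ
  charge v = 2 * d v + Δ * weakDeg v

  -- Δ + 1 − d^Δ(v), expanded through d(v) = d^Δ(v) + nonmaxDeg v.
  threshold : Fin n → ℕ
  threshold v = suc (nonmaxDeg v + (Δ ∸ d v))

  deg≤Δ : ∀ v → d v ≤ Δ
  deg≤Δ = f≤maxF n d

  poor⇒weakDeg≡0 : ∀ {x} → poor x ≡ true → weakDeg x ≡ 0
  poor⇒weakDeg≡0 {x} px = ≡ᵇ⇒≡ (weakDeg x) 0 (Equivalence.from T-≡ (∧-conicalˡ _ _ px))

  poor⇒2deg≤Δ : ∀ {x} → poor x ≡ true → 2 * d x ≤ Δ
  poor⇒2deg≤Δ {x} px = ≤ᵇ⇒≤ (2 * d x) Δ (Equivalence.from T-≡ (∧-conicalʳ _ _ px))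

  poor⇒deg<Δ : ∀ {x} → poor x ≡ true → d x < Δ
  poor⇒deg<Δ {x} px =
    <-≤-trans (subst (d x <_) (cong (d x +_) (sym (+-identityʳ (d x)))) (m<m+n (d x) (deg≥1 x)))
              (poor⇒2deg≤Δ px)

  poor⇒deg≢ᵇΔ : ∀ {x} → poor x ≡ true → (d x ≡ᵇ Δ) ≡ false
  poor⇒deg≢ᵇΔ {x} px = dec-false (d x ≟ Δ) (<⇒≢ (poor⇒deg<Δ px))

  poor-intro : ∀ {v} → weakDeg v ≡ 0 → 2 * d v ≤ Δ → poor v ≡ true
  poor-intro weakDeg≡0 2d≤Δ = cong₂ _∧_ (cong (_≡ᵇ 0) weakDeg≡0) (Equivalence.to T-≡ (≤⇒≤ᵇ 2d≤Δ))

  received-poor : ∀ {x} → poor x ≡ true → received x ≡ d x * share (d x)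
  received-poor {x} px = begin
      sumF n (λ v → 𝟙 (adj G v x ∧ poor x) * share (d x))
    ≡⟨ sumF-*ʳ n (share (d x)) _ ⟩
      sumF n (λ v → 𝟙 (adj G v x ∧ poor x)) * share (d x)
    ≡⟨ cong (_* share (d x)) (sumF-cong n (λ v → cong 𝟙 (adj∧poor≡adj v))) ⟩
      sumF n (λ v → 𝟙 (adj G x v)) * share (d x)
    ≡⟨ cong (_* share (d x)) (sym (count≡sumF𝟙 n (adj G x))) ⟩
      d x * share (d x)
    ∎
    where
    open ≡-Reasoning
    adj∧poor≡adj : ∀ v → (adj G v x ∧ poor x) ≡ adj G x v
    adj∧poor≡adj v = trans (cong (adj G v x ∧_) px) (trans (∧-identityʳ _) (Graph.sym G v x))

  -- The edge vx is not (Δ,v)-weak, since x has no weak edge at all.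
  poor-neighbour-bound : ∀ {v x} → adj G v x ≡ true → poor x ≡ true → Δ < degD G Δ v + d x
  poor-neighbour-bound {v} {x} vx px =
    ≰⇒> (λ le → subst T not-weakAt (≤⇒≤ᵇ (≤-trans le (m≤m+n Δ _))))
    where
    not-weak : weak G Δ x v ≡ false
    not-weak = trans (cong (_∧ weak G Δ x v) (sym (trans (Graph.sym G x v) vx)))
                     (count≡0⇒false n _ (poor⇒weakDeg≡0 px) v)
    not-weakAt : weakAt G Δ v x ≡ false
    not-weakAt = ∨-conicalʳ _ _ not-weak

  degΔ+nonmaxDeg≡deg : ∀ v → degD G Δ v + nonmaxDeg v ≡ d v
  degΔ+nonmaxDeg≡deg v = count-∧-split n (adj G v) (λ u → d u ≡ᵇ Δ)

  degΔ+nonmaxDeg+slack≡Δ : ∀ v → degD G Δ v + nonmaxDeg v + (Δ ∸ d v) ≡ Δ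
  degΔ+nonmaxDeg+slack≡Δ v =
    trans (cong (_+ (Δ ∸ d v)) (degΔ+nonmaxDeg≡deg v)) (m+[n∸m]≡n (deg≤Δ v))

  threshold≤poor-neighbour : ∀ {v y} → (adj G v y ∧ poor y) ≡ true → threshold v ≤ d y
  threshold≤poor-neighbour {v} {y} vy∧py =
    +-cancelˡ-≤ (degD G Δ v) (threshold v) (d y)
      (subst (_≤ degD G Δ v + d y) (sym degΔ+threshold≡1+Δ)
        (poor-neighbour-bound (∧-conicalˡ _ _ vy∧py) (∧-conicalʳ (adj G v y) _ vy∧py)))
    where
    degΔ+threshold≡1+Δ : degD G Δ v + threshold v ≡ suc Δ
    degΔ+threshold≡1+Δ = trans (+-suc (degD G Δ v) _)
      (cong suc (trans (sym (+-assoc (degD G Δ v) _ _)) (degΔ+nonmaxDeg+slack≡Δ v)))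

  share-antitone : ∀ j {k} → suc j ≤ k → share k ≤ share (suc j)
  share-antitone j {suc k} j≤k = ∸-monoˡ-≤ 1 (/-monoʳ-≤ Δ j≤k)

  sent≤nonmaxDeg*share : ∀ v → sent v ≤ nonmaxDeg v * share (threshold v)
  sent≤nonmaxDeg*share v = begin
      sumF n (transfer v)                      ≤⟨ sumF-mono-≤ n transfer≤ ⟩
      sumF n (λ y → 𝟙 (nonmax-nbr y) * share K) ≡⟨ sumF-*ʳ n (share K) _ ⟩
      sumF n (λ y → 𝟙 (nonmax-nbr y)) * share K ≡⟨ cong (_* share K) (sym (count≡sumF𝟙 n _)) ⟩
      nonmaxDeg v * share K                    ∎
    where
    open ≤-Reasoning
    K : ℕ
    K = threshold v
    nonmax-nbr : Fin n → Bool
    nonmax-nbr y = adj G v y ∧ not (d y ≡ᵇ Δ)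
    poor-nbr⇒nonmax-nbr : ∀ {y} → (adj G v y ∧ poor y) ≡ true → nonmax-nbr y ≡ true
    poor-nbr⇒nonmax-nbr {y} vy∧py =
      cong₂ _∧_ (∧-conicalˡ _ _ vy∧py)
                (cong not (poor⇒deg≢ᵇΔ (∧-conicalʳ (adj G v y) _ vy∧py)))
    transfer≤ : ∀ y → transfer v y ≤ 𝟙 (nonmax-nbr y) * share K
    transfer≤ y with adj G v y ∧ poor y in vy∧py
    ... | false = z≤n
    ... | true  = subst (λ b → share (d y) + 0 ≤ 𝟙 b * share K) (sym (poor-nbr⇒nonmax-nbr vy∧py))
                        (+-monoˡ-≤ 0 (share-antitone _ (threshold≤poor-neighbour vy∧py)))

  sent+Δ<2deg : ∀ {v x} → (adj G v x ∧ poor x) ≡ true → sent v + suc Δ ≤ 2 * d v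
  sent+Δ<2deg {v} {x} vx∧px = begin
      sent v + suc Δ                     ≤⟨ +-monoˡ-≤ (suc Δ) (sent≤nonmaxDeg*share v) ⟩
      t * share K + suc Δ                ≡⟨ cong (λ z → t * share K + suc z) (sym h+t+s≡Δ) ⟩
      t * (Δ / K ∸ 1) + suc (h + t + s)  ≤⟨ t*[q∸1]+h+t+s<2*[h+t] h t s (Δ / K) [Δ/K]*K≤Δ 2K≤Δ ⟩
      2 * (h + t)                        ≡⟨ cong (2 *_) (degΔ+nonmaxDeg≡deg v) ⟩
      2 * d v                            ∎
    where
    open ≤-Reasoning
    h t s K : ℕ
    h = degD G Δ v
    t = nonmaxDeg v
    s = Δ ∸ d v
    K = threshold v
    h+t+s≡Δ : h + t + s ≡ Δ
    h+t+s≡Δ = degΔ+nonmaxDeg+slack≡Δ v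
    [Δ/K]*K≤Δ : Δ / K * K ≤ h + t + s
    [Δ/K]*K≤Δ = subst (Δ / K * K ≤_) (sym h+t+s≡Δ) (m/n*n≤m Δ K)
    2K≤Δ : 2 * K ≤ h + t + s
    2K≤Δ = subst (2 * K ≤_) (sym h+t+s≡Δ)
      (≤-trans (*-monoʳ-≤ 2 (threshold≤poor-neighbour vx∧px))
               (poor⇒2deg≤Δ (∧-conicalʳ (adj G v x) _ vx∧px)))

  poor⇒Δ<charge+received : ∀ {v} → poor v ≡ true → suc Δ ≤ charge v + received v
  poor⇒Δ<charge+received {v} pv rewrite received-poor pv =
    ≤-trans (Δ<2k+k*share[k] (d v) (deg≥1 v)) (+-monoˡ-≤ _ (m≤m+n (2 * d v) (Δ * weakDeg v)))
    where
    Δ<2k+k*share[k] : ∀ k → 1 ≤ k → Δ < 2 * k + k * share k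
    Δ<2k+k*share[k] (suc k) _ = D<2k+k*[D/k∸1] Δ (suc k)

  ¬poor⇒Δ<charge : ∀ {v} → poor v ≡ false → suc Δ ≤ charge v
  ¬poor⇒Δ<charge {v} ¬pv with 2 * d v ≤? Δ | weakDeg v ≟ 0
  ... | no 2d≰Δ | _       = ≤-trans (≰⇒> 2d≰Δ) (m≤m+n (2 * d v) _)
  ... | yes _   | no w≢0  =
    +-mono-≤ (≤-trans (deg≥1 v) (m≤m+n (d v) _)) (m≤m*n Δ (weakDeg v) {{≢-nonZero w≢0}})
  ... | yes 2d≤Δ | yes w≡0 with () ← trans (sym (poor-intro w≡0 2d≤Δ)) ¬pv

  Δ<charge+received : ∀ v → suc Δ ≤ charge v + received v
  Δ<charge+received v = by-cases (poor v) refl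
    where
    by-cases : ∀ b → poor v ≡ b → suc Δ ≤ charge v + received v
    by-cases true  pv = poor⇒Δ<charge+received pv
    by-cases false pv = ≤-trans (¬poor⇒Δ<charge pv) (m≤m+n (charge v) (received v))

  sent+Δ<charge+received : ∀ v → sent v + suc Δ ≤ charge v + received v
  sent+Δ<charge+received v with sent v ≟ 0
  ... | yes sent≡0 =
    subst (λ z → z + suc Δ ≤ charge v + received v) (sym sent≡0) (Δ<charge+received v)
  ... | no  sent≢0 with sumF≢0⇒∃≢0 n (transfer v) sent≢0
  ...   | _ , transfer≢0 =
    ≤-trans (sent+Δ<2deg (𝟙*≢0⇒true transfer≢0)) (≤-trans (m≤m+n _ _) (m≤m+n _ _))

  n[1+Δ]≤Σcharge : n * suc Δ ≤ sumF n charge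
  n[1+Δ]≤Σcharge = +-cancelʳ-≤ Σreceived (n * suc Δ) (sumF n charge) (begin
      n * suc Δ + Σreceived                    ≡⟨ +-comm (n * suc Δ) Σreceived ⟩
      Σreceived + n * suc Δ                    ≡⟨ cong₂ _+_ (sym (sumF-comm n n transfer))
                                                            (sym (sumF-const n (suc Δ))) ⟩
      sumF n sent + sumF n (λ _ → suc Δ)       ≡⟨ sym (sumF-distrib-+ n sent (λ _ → suc Δ)) ⟩
      sumF n (λ v → sent v + suc Δ)            ≤⟨ sumF-mono-≤ n sent+Δ<charge+received ⟩
      sumF n (λ v → charge v + received v)     ≡⟨ sumF-distrib-+ n charge received ⟩
      sumF n charge + Σreceived                ∎)
    where
    open ≤-Reasoning
    Σreceived : ℕ
    Σreceived = sumF n received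

  Σdeg≡2|E| : sumF n d ≡ 2 * numEdges G
  Σdeg≡2|E| = handshake n (adj G) (Graph.sym G) (Graph.irrefl G)

  Σcharge≡4|E|+2ΔW : sumF n charge ≡ 2 * (2 * numEdges G) + Δ * (2 * numWeakEdges G Δ)
  Σcharge≡4|E|+2ΔW = begin
      sumF n charge
    ≡⟨ sumF-distrib-+ n _ _ ⟩
      sumF n (λ v → 2 * d v) + sumF n (λ v → Δ * weakDeg v)
    ≡⟨ cong₂ _+_ (sumF-*ˡ n 2 d) (sumF-*ˡ n Δ weakDeg) ⟩
      2 * sumF n d + Δ * sumF n weakDeg
    ≡⟨ cong₂ (λ a b → 2 * a + Δ * b) Σdeg≡2|E| Σweak≡2W ⟩
      2 * (2 * numEdges G) + Δ * (2 * numWeakEdges G Δ)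
    ∎
    where
    open ≡-Reasoning
    Σweak≡2W : sumF n weakDeg ≡ 2 * numWeakEdges G Δ
    Σweak≡2W = handshake n (λ u v → adj G u v ∧ weak G Δ u v)
      (λ u v → cong₂ _∧_ (Graph.sym G u v) (∨-comm (weakAt G Δ u v) (weakAt G Δ v u)))
      (λ v → cong (_∧ weak G Δ v v) (Graph.irrefl G v))

  n≤2|E| : n ≤ 2 * numEdges G
  n≤2|E| = subst₂ _≤_ (trans (sumF-const n 1) (*-identityʳ n)) Σdeg≡2|E| (sumF-mono-≤ n deg≥1)

theorem3 : (n : ℕ) → (G : Graph n) →
    0 < n →
    (∀ (v : Fin n) → 1 ≤ deg G v) →
    2 * (2 * numEdges G) ≤ maxDeg G * n →
    numEdges G * n ^ 2 ≤ numWeakEdges G (maxDeg G) * 2 * (2 * numEdges G) ^ 2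
theorem3 zero      _ () _     _
theorem3 n@(suc _) G _  deg≥1 4|E|≤Δn = begin
    |E| * n ^ 2                        ≡⟨ cong (λ k → |E| * (n * k)) (*-identityʳ n) ⟩
    |E| * (n * n)                      ≤⟨ *-monoʳ-≤ |E| n²≤4|E|*2W ⟩
    |E| * (2 * (2 * |E|) * (2 * W))    ≡⟨ rearrange |E| W ⟩
    W * 2 * (2 * |E|) ^ 2              ∎
  where
  open ≤-Reasoning
  open Discharging G deg≥1 using (Δ; deg≤Δ; n[1+Δ]≤Σcharge; Σcharge≡4|E|+2ΔW; n≤2|E|)
  |E| W : ℕ
  |E| = numEdges G
  W   = numWeakEdges G Δ
  instance
    Δ≢0 : NonZero Δ
    Δ≢0 = >-nonZero (≤-trans (deg≥1 zero) (deg≤Δ zero))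
  n²≤4|E|*2W : n * n ≤ 2 * (2 * |E|) * (2 * W)
  n²≤4|E|*2W = n*n≤p*W (≤-trans n≤2|E| (m≤m+n (2 * |E|) _)) 4|E|≤Δn
                       (subst (n * suc Δ ≤_) Σcharge≡4|E|+2ΔW n[1+Δ]≤Σcharge)
  rearrange : ∀ e w → e * (2 * (2 * e) * (2 * w)) ≡ w * 2 * (2 * e * (2 * e * 1))
  rearrange = solve-∀
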